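{- Let $r\leq 3$, let $L_1,\dots,L_r\subseteq V(C_6)$ be incomparable sets, let $L\subseteq V(C_6)$, and let $S\in L_1\times\dots\times L_r$ be an $r$-tuple without a common neighbor in $L$. Then $S$ can be forbidden by a polynomial of degree $2$ with respect to $(L_1\times\dots\times L_r,L)$.
   Context: $C_6$ is the (loopless) cycle on 6 vertices; $N(v)$ is the neighborhood of $v$; vertices $u,v$ are incomparable if neither $N(u)\subseteq N(v)$ nor $N(v)\subseteq N(u)$, and a set is incomparable if its vertices are pairwise incomparable. A tuple has a common neighbor in $L$ if some vertex of $L$ is adjacent to all its entries. Polynomial forbidding (with $H=C_6$): for a finite set $X$, introduce Boolean variables $y_{v,u}$ ($v\in X$, $u\in V(H)$), collected in $\mathbf{y}$; $\mathbf{y}$ is a choice assignment if $\sum_{u}y_{v,u}=1$ for every $v\in X$. Given $F=L_1\times\dots\times L_r$, $L$, and $S=(s_1,\dots,s_r)\in F$ with no common neighbor in $L$, $S$ can be forbidden (on distinct $v_1,\dots,v_r\in X$) by a polynomial of degree $d$ with respect to $(F,L)$ if there is a polynomial $p$ over GF(2) of degree at most $d$ in $\mathbf{y}$ such that for every choice assignment, letting $s_\ell'$ be the unique vertex with $y_{v_\ell,s_\ell'}=1$ and $S'=(s_1',\dots,s_r')$: if $S'=S$ then $p(\mathbf{y})\ne0$, and if $S'$ has a common neighbor in $L$ then $p(\mathbf{y})=0$. The claim is for arbitrary finite $X$ and distinct $v_1,\dots,v_r\in X$. -}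

module Defs where

open import Data.Nat using (ℕ; _+_; _≤_)
open import Data.Nat.DivMod using (_%_)
open import Data.Fin using (Fin; toℕ)
open import Data.Fin.Subset using (Subset; _∈_)
open import Data.Bool using (Bool; true; false; _xor_; _∧_)
open import Data.List using (List; []; _∷_; length)
open import Data.List.Relation.Unary.All using (All)
open import Data.Product using (Σ; ∃; _×_; _,_)
open import Data.Sum using (_⊎_)
open import Relation.Binary.PropositionalEquality using (_≡_; _≢_)
open import Relation.Nullary using (¬_)

Adj : Fin 6 → Fin 6 → Set
Adj i j = (toℕ j ≡ (toℕ i + 1) % 6) ⊎ (toℕ i ≡ (toℕ j + 1) % 6)

NbhdSub : Fin 6 → Fin 6 → Set
NbhdSub u v = ∀ w → Adj u w → Adj v w

Incomparable : Fin 6 → Fin 6 → Set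
Incomparable u v = ¬ NbhdSub u v × ¬ NbhdSub v u

IncomparableSet : Subset 6 → Set
IncomparableSet A = ∀ u v → u ∈ A → v ∈ A → u ≢ v → Incomparable u v

HasCommonNeighbor : ∀ {r} → Subset 6 → (Fin r → Fin 6) → Set
HasCommonNeighbor L S = ∃ λ w → w ∈ L × (∀ ℓ → Adj w (S ℓ))

InProduct : ∀ {r} → (Fin r → Subset 6) → (Fin r → Fin 6) → Set
InProduct Ls S = ∀ ℓ → S ℓ ∈ Ls ℓ

-- Polynomials over GF(2) in the variables y_{v,u}, v ∈ X = Fin m,
-- u ∈ V(C₆). A monomial is a list of variables (a product, repetitions
-- allowed); a polynomial is a list of monomials (their GF(2)-sum).

Var : ℕ → Set
Var m = Fin m × Fin 6

Monomial : ℕ → Set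
Monomial m = List (Var m)

Poly : ℕ → Set
Poly m = List (Monomial m)

Assignment : ℕ → Set
Assignment m = Fin m → Fin 6 → Bool

evalMono : ∀ {m} → Assignment m → Monomial m → Bool
evalMono y []             = true
evalMono y ((v , u) ∷ xs) = y v u ∧ evalMono y xs

evalPoly : ∀ {m} → Assignment m → Poly m → Bool
evalPoly y []       = false
evalPoly y (t ∷ ts) = evalMono y t xor evalPoly y ts

DegreeAtMost : ∀ {m} → ℕ → Poly m → Set
DegreeAtMost d p = All (λ t → length t ≤ d) p

ChoiceAssignment : ∀ {m} → Assignment m → Set
ChoiceAssignment y =
  ∀ v → ∃ λ u → (y v u ≡ true) × (∀ u' → y v u' ≡ true → u' ≡ u)

CanBeForbidden : ∀ {r} m → (Fin r → Fin m) → (Fin r → Subset 6) → Subset 6 →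
                 (Fin r → Fin 6) → ℕ → Set
CanBeForbidden {r} m vs Ls L S d =
  Σ (Poly m) λ p → DegreeAtMost d p ×
    (∀ (y : Assignment m) → ChoiceAssignment y →
     ∀ (S' : Fin r → Fin 6) → (∀ ℓ → y (vs ℓ) (S' ℓ) ≡ true) →
       ((∀ ℓ → S' ℓ ≡ S ℓ) → evalPoly y p ≢ false) ×
       (HasCommonNeighbor L S' → evalPoly y p ≡ false))

-- On a choice assignment y_{v_ℓ,u} is the indicator [S'_ℓ = u], so polynomials
-- only need to be designed on tuples. If at most two entries of S already have no
-- common neighbour in L, the product of their variables forbids S. Otherwise r = 3,
-- the entries a, b, c of S are distinct, and we count mod 2 the pairs of positions
-- carrying {a, b}: S has exactly one such pair, while the entries of a tuple with a
-- common neighbour lie in a two-element neighbourhood of C₆, so two of them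
-- coincide and the count is even.
module Submission where

open import Defs
open import Data.Nat using (ℕ; _+_; _≤_; s≤s)
import Data.Nat.Properties as ℕ
open import Data.Nat.Properties using (≤-refl; ≤-trans; ≤-reflexive; m≤n⇒m<n∨m≡n)
open import Data.Nat.DivMod using (_%_)
open import Data.Fin using (Fin; zero; suc; toℕ)
open import Data.Fin.Properties using (_≟_; any?; all?)
open import Data.Fin.Subset using (Subset; _∈_)
open import Data.Fin.Subset.Properties using (_∈?_)
open import Data.Bool using (Bool; true; false; _xor_; _∧_)
open import Data.Bool.Properties
  using (xor-same; xor-comm; xor-assoc; xor-identityʳ; ∧-comm; ∧-identityʳ; ¬-not; not-¬)
open import Data.List using (List; []; _∷_; _++_; length; map; allFin)
open import Data.List.Properties using (length-map; length-tabulate)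
open import Data.List.Relation.Unary.All as All using (All; []; _∷_)
open import Data.List.Relation.Unary.All.Properties using (map⁺)
open import Data.List.Membership.Propositional.Properties using (∈-allFin)
open import Data.Product using (Σ; ∃; _×_; _,_)
open import Data.Sum using (_⊎_; inj₁; inj₂)
open import Function using (_∘_; id)
open import Function.Definitions using (Injective)
open import Relation.Binary.PropositionalEquality
  using (_≡_; _≢_; refl; sym; trans; cong; cong₂; subst; ≢-sym; module ≡-Reasoning)
open import Relation.Nullary using (¬_; Dec; does; yes; no)
open import Relation.Nullary.Decidable
  using (_⊎-dec_; _×-dec_; _→-dec_; toWitness; dec-true; dec-false)

private
  variable
    r m d : ℕ
    L : Subset 6

adj? : ∀ u v → Dec (Adj u v)
adj? u v = (toℕ v ℕ.≟ (toℕ u + 1) % 6) ⊎-dec (toℕ u ℕ.≟ (toℕ v + 1) % 6)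

neighbours-collide : ∀ w x y z → Adj w x → Adj w y → Adj w z →
                     x ≡ y ⊎ x ≡ z ⊎ y ≡ z
neighbours-collide = toWitness {a? = all? λ w → all? λ x → all? λ y → all? λ z →
  adj? w x →-dec adj? w y →-dec adj? w z →-dec (x ≟ y ⊎-dec x ≟ z ⊎-dec y ≟ z)} _

TupleMonomial : ℕ → Set
TupleMonomial r = List (Fin r × Fin 6)

TuplePoly : ℕ → Set
TuplePoly r = List (TupleMonomial r)

evalTupleMono : (Fin r → Fin 6) → TupleMonomial r → Bool
evalTupleMono T []            = true
evalTupleMono T ((ℓ , u) ∷ t) = does (T ℓ ≟ u) ∧ evalTupleMono T t

evalTuplePoly : (Fin r → Fin 6) → TuplePoly r → Bool
evalTuplePoly T []      = false
evalTuplePoly T (t ∷ Q) = evalTupleMono T t xor evalTuplePoly T Q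

evalTupleMono-cong : ∀ {T T′ : Fin r → Fin 6} → (∀ ℓ → T ℓ ≡ T′ ℓ) →
                     ∀ t → evalTupleMono T t ≡ evalTupleMono T′ t
evalTupleMono-cong T≗T′ []            = refl
evalTupleMono-cong T≗T′ ((ℓ , u) ∷ t) =
  cong₂ (λ x b → does (x ≟ u) ∧ b) (T≗T′ ℓ) (evalTupleMono-cong T≗T′ t)

evalTuplePoly-cong : ∀ {T T′ : Fin r → Fin 6} → (∀ ℓ → T ℓ ≡ T′ ℓ) →
                     ∀ Q → evalTuplePoly T Q ≡ evalTuplePoly T′ Q
evalTuplePoly-cong T≗T′ []      = refl
evalTuplePoly-cong T≗T′ (t ∷ Q) =
  cong₂ _xor_ (evalTupleMono-cong T≗T′ t) (evalTuplePoly-cong T≗T′ Q)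

evalTuplePoly-++ : ∀ (T : Fin r → Fin 6) P Q →
                   evalTuplePoly T (P ++ Q) ≡ evalTuplePoly T P xor evalTuplePoly T Q
evalTuplePoly-++ T []      Q = refl
evalTuplePoly-++ T (t ∷ P) Q =
  trans (cong (evalTupleMono T t xor_) (evalTuplePoly-++ T P Q))
        (sym (xor-assoc (evalTupleMono T t) _ _))

Forbids : Subset 6 → (Fin r → Fin 6) → TuplePoly r → Set
Forbids L S Q = evalTuplePoly S Q ≡ true ×
                (∀ T → HasCommonNeighbor L T → evalTuplePoly T Q ≡ false)

TupleForbiddable : ℕ → Subset 6 → (Fin r → Fin 6) → Set
TupleForbiddable {r} d L S =
  Σ (TuplePoly r) λ Q → All (λ t → length t ≤ d) Q × Forbids L S Q

instantiateMono : (Fin r → Fin m) → TupleMonomial r → Monomial m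
instantiateMono vs = map λ (ℓ , u) → vs ℓ , u

instantiate : (Fin r → Fin m) → TuplePoly r → Poly m
instantiate vs = map (instantiateMono vs)

module _ (vs : Fin r → Fin m) {y : Assignment m} (choice : ChoiceAssignment y)
         {S′ : Fin r → Fin 6} (selects : ∀ ℓ → y (vs ℓ) (S′ ℓ) ≡ true) where

  choice-indicator : ∀ ℓ u → y (vs ℓ) u ≡ does (S′ ℓ ≟ u)
  choice-indicator ℓ u with S′ ℓ ≟ u | choice (vs ℓ)
  ... | yes refl  | _                 = selects ℓ
  ... | no S′ℓ≢u | (_ , _ , unique) =
    ¬-not λ yu → S′ℓ≢u (trans (unique (S′ ℓ) (selects ℓ)) (sym (unique u yu)))

  evalMono-instantiate : ∀ t → evalMono y (instantiateMono vs t) ≡ evalTupleMono S′ t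
  evalMono-instantiate []            = refl
  evalMono-instantiate ((ℓ , u) ∷ t) =
    cong₂ _∧_ (choice-indicator ℓ u) (evalMono-instantiate t)

  evalPoly-instantiate : ∀ Q → evalPoly y (instantiate vs Q) ≡ evalTuplePoly S′ Q
  evalPoly-instantiate []      = refl
  evalPoly-instantiate (t ∷ Q) =
    cong₂ _xor_ (evalMono-instantiate t) (evalPoly-instantiate Q)

instantiate-degree : (vs : Fin r → Fin m) {Q : TuplePoly r} →
                     All (λ t → length t ≤ d) Q → DegreeAtMost d (instantiate vs Q)
instantiate-degree vs =
  map⁺ ∘ All.map λ {t} t≤d → ≤-trans (≤-reflexive (length-map _ t)) t≤d

canBeForbidden : ∀ {S : Fin r → Fin 6} (vs : Fin r → Fin m) Ls →
                 TupleForbiddable d L S → CanBeForbidden m vs Ls L S d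
canBeForbidden {S = S} vs Ls (Q , Q≤d , S-true , neighbour-false) =
  instantiate vs Q , instantiate-degree vs Q≤d , λ y choice S′ selects →
    let open ≡-Reasoning in
    (λ S′≗S → not-¬ (begin
       evalPoly y (instantiate vs Q) ≡⟨ evalPoly-instantiate vs choice selects Q ⟩
       evalTuplePoly S′ Q            ≡⟨ evalTuplePoly-cong S′≗S Q ⟩
       evalTuplePoly S Q             ≡⟨ S-true ⟩
       true                          ∎))
    , λ cn → trans (evalPoly-instantiate vs choice selects Q) (neighbour-false S′ cn)

CommonNeighbourOn : Subset 6 → (Fin r → Fin 6) → List (Fin r) → Set
CommonNeighbourOn L S I = ∃ λ w → w ∈ L × All (λ ℓ → Adj w (S ℓ)) I

commonNeighbourOn? : ∀ L (S : Fin r → Fin 6) I → Dec (CommonNeighbourOn L S I)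
commonNeighbourOn? L S I = any? λ w → w ∈? L ×-dec All.all? (adj? w ∘ S) I

commonNeighbourOn-allFin : {S : Fin r → Fin 6} →
                           CommonNeighbourOn L S (allFin r) → HasCommonNeighbor L S
commonNeighbourOn-allFin (w , w∈L , adj) = w , w∈L , λ ℓ → All.lookup adj (∈-allFin ℓ)

monomialAt : (Fin r → Fin 6) → List (Fin r) → TupleMonomial r
monomialAt S = map λ ℓ → ℓ , S ℓ

evalTupleMono-monomialAt-self : ∀ (S : Fin r → Fin 6) I →
                                evalTupleMono S (monomialAt S I) ≡ true
evalTupleMono-monomialAt-self S []      = refl
evalTupleMono-monomialAt-self S (ℓ ∷ I) =
  cong₂ _∧_ (dec-true (S ℓ ≟ S ℓ) refl) (evalTupleMono-monomialAt-self S I)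

evalTupleMono-monomialAt-agree : ∀ (T S : Fin r → Fin 6) I →
  evalTupleMono T (monomialAt S I) ≡ true → All (λ ℓ → T ℓ ≡ S ℓ) I
evalTupleMono-monomialAt-agree T S []      _ = []
evalTupleMono-monomialAt-agree T S (ℓ ∷ I) h with T ℓ ≟ S ℓ
evalTupleMono-monomialAt-agree T S (ℓ ∷ I) h  | yes Tℓ≡Sℓ =
  Tℓ≡Sℓ ∷ evalTupleMono-monomialAt-agree T S I h
evalTupleMono-monomialAt-agree T S (ℓ ∷ I) () | no _

forbidden-by-subtuple : ∀ (S : Fin r → Fin 6) I → length I ≤ d →
                        ¬ CommonNeighbourOn L S I → TupleForbiddable d L S
forbidden-by-subtuple S I I≤d noCN =
  monomialAt S I ∷ [] , ≤-trans (≤-reflexive (length-map _ I)) I≤d ∷ [] ,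
  trans (xor-identityʳ _) (evalTupleMono-monomialAt-self S I) , neighbour-false
  where
  neighbour-false : ∀ T → HasCommonNeighbor _ T →
                    evalTuplePoly T (monomialAt S I ∷ []) ≡ false
  neighbour-false T (w , w∈L , adj) = trans (xor-identityʳ _) (¬-not λ hit →
    noCN (w , w∈L , All.map (λ {ℓ} Tℓ≡Sℓ → subst (Adj w) Tℓ≡Sℓ (adj ℓ))
                            (evalTupleMono-monomialAt-agree T S I hit)))

forbidden-short : ∀ (S : Fin r → Fin 6) → r ≤ 2 → ¬ HasCommonNeighbor L S →
                  TupleForbiddable 2 L S
forbidden-short S r≤2 noCN =
  forbidden-by-subtuple S (allFin _) (≤-trans (≤-reflexive (length-tabulate id)) r≤2)
                        (noCN ∘ commonNeighbourOn-allFin)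

swapPair : Fin r → Fin r → Fin 6 → Fin 6 → TuplePoly r
swapPair i j a b = ((i , a) ∷ (j , b) ∷ []) ∷ ((i , b) ∷ (j , a) ∷ []) ∷ []

hits : Fin 6 → Fin 6 → Fin 6 → Fin 6 → Bool
hits a b x y = (does (x ≟ a) ∧ does (y ≟ b)) xor (does (x ≟ b) ∧ does (y ≟ a))

evalTuplePoly-swapPair : ∀ (T : Fin r → Fin 6) i j a b →
                         evalTuplePoly T (swapPair i j a b) ≡ hits a b (T i) (T j)
evalTuplePoly-swapPair T i j a b
  rewrite ∧-identityʳ (does (T j ≟ b)) | ∧-identityʳ (does (T j ≟ a))
        | xor-identityʳ (does (T i ≟ b) ∧ does (T j ≟ a)) = refl

hits-comm : ∀ a b x y → hits a b x y ≡ hits a b y x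
hits-comm a b x y
  rewrite ∧-comm (does (x ≟ a)) (does (y ≟ b)) | ∧-comm (does (x ≟ b)) (does (y ≟ a)) =
  xor-comm (does (y ≟ b) ∧ does (x ≟ a)) _

hits-diagonal : ∀ a b x → hits a b x x ≡ false
hits-diagonal a b x =
  trans (cong (does (x ≟ a) ∧ does (x ≟ b) xor_) (∧-comm (does (x ≟ b)) (does (x ≟ a))))
        (xor-same (does (x ≟ a) ∧ does (x ≟ b)))

hits-cancel : ∀ a b x y z → x ≡ y ⊎ x ≡ z ⊎ y ≡ z →
              hits a b x y xor (hits a b x z xor hits a b y z) ≡ false
hits-cancel a b x _ z (inj₁ refl) =
  cong₂ _xor_ (hits-diagonal a b x) (xor-same (hits a b x z))
hits-cancel a b x y _ (inj₂ (inj₁ refl)) = begin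
  hits a b x y xor (hits a b x x xor hits a b y x)
    ≡⟨ cong (λ h → hits a b x y xor (h xor hits a b y x)) (hits-diagonal a b x) ⟩
  hits a b x y xor hits a b y x
    ≡⟨ cong (hits a b x y xor_) (hits-comm a b y x) ⟩
  hits a b x y xor hits a b x y
    ≡⟨ xor-same (hits a b x y) ⟩
  false ∎
  where open ≡-Reasoning
hits-cancel a b x y _ (inj₂ (inj₂ refl)) = begin
  hits a b x y xor (hits a b x y xor hits a b y y)
    ≡⟨ cong (λ h → hits a b x y xor (hits a b x y xor h)) (hits-diagonal a b y) ⟩
  hits a b x y xor (hits a b x y xor false)
    ≡⟨ cong (hits a b x y xor_) (xor-identityʳ _) ⟩
  hits a b x y xor hits a b x y
    ≡⟨ xor-same (hits a b x y) ⟩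
  false ∎
  where open ≡-Reasoning

hits-distinct : ∀ {a b c} → a ≢ b → a ≢ c → b ≢ c →
                hits a b a b xor (hits a b a c xor hits a b b c) ≡ true
hits-distinct {a} {b} {c} a≢b a≢c b≢c
  rewrite dec-true (a ≟ a) refl | dec-true (b ≟ b) refl
        | dec-false (a ≟ b) a≢b | dec-false (b ≟ a) (≢-sym a≢b)
        | dec-false (c ≟ a) (≢-sym a≢c) | dec-false (c ≟ b) (≢-sym b≢c) = refl

0₃ 1₃ 2₃ : Fin 3
0₃ = zero
1₃ = suc zero
2₃ = suc (suc zero)

pairsOf : Fin 6 → Fin 6 → TuplePoly 3
pairsOf a b = swapPair 0₃ 1₃ a b ++ swapPair 0₃ 2₃ a b ++ swapPair 1₃ 2₃ a b

evalTuplePoly-pairsOf : ∀ (T : Fin 3 → Fin 6) a b →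
  evalTuplePoly T (pairsOf a b) ≡
    hits a b (T 0₃) (T 1₃) xor
    (hits a b (T 0₃) (T 2₃) xor hits a b (T 1₃) (T 2₃))
evalTuplePoly-pairsOf T a b =
  trans (evalTuplePoly-++ T (swapPair 0₃ 1₃ a b)
                          (swapPair 0₃ 2₃ a b ++ swapPair 1₃ 2₃ a b))
    (cong₂ _xor_ (evalTuplePoly-swapPair T 0₃ 1₃ a b)
      (trans (evalTuplePoly-++ T (swapPair 0₃ 2₃ a b) (swapPair 1₃ 2₃ a b))
        (cong₂ _xor_ (evalTuplePoly-swapPair T 0₃ 2₃ a b)
          (evalTuplePoly-swapPair T 1₃ 2₃ a b))))

commonNeighbour-triple : ∀ {S : Fin 3 → Fin 6} {w} → w ∈ L →
  Adj w (S 0₃) → Adj w (S 1₃) → Adj w (S 2₃) →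
  HasCommonNeighbor L S
commonNeighbour-triple w∈L a₀ a₁ a₂ =
  _ , w∈L , λ { zero → a₀ ; (suc zero) → a₁ ; (suc (suc zero)) → a₂ }

forbidden-triple : ∀ (S : Fin 3 → Fin 6) → ¬ HasCommonNeighbor L S →
                   TupleForbiddable 2 L S
forbidden-triple {L} S noCN
  with commonNeighbourOn? L S (0₃ ∷ 1₃ ∷ [])
     | commonNeighbourOn? L S (0₃ ∷ 2₃ ∷ [])
     | commonNeighbourOn? L S (1₃ ∷ 2₃ ∷ [])
... | no noCN₀₁ | _ | _ = forbidden-by-subtuple S _ ≤-refl noCN₀₁
... | yes _ | no noCN₀₂ | _ = forbidden-by-subtuple S _ ≤-refl noCN₀₂
... | yes _ | yes _ | no noCN₁₂ = forbidden-by-subtuple S _ ≤-refl noCN₁₂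
... | yes (u , u∈L , u₀ ∷ u₁ ∷ [])
    | yes (v , v∈L , v₀ ∷ v₂ ∷ [])
    | yes (w , w∈L , w₁ ∷ w₂ ∷ []) =
  pairsOf (S 0₃) (S 1₃) ,
  ≤-refl ∷ ≤-refl ∷ ≤-refl ∷ ≤-refl ∷ ≤-refl ∷ ≤-refl ∷ [] ,
  trans (evalTuplePoly-pairsOf S _ _) (hits-distinct S₀≢S₁ S₀≢S₂ S₁≢S₂) ,
  λ { T (x , _ , adj) → trans (evalTuplePoly-pairsOf T _ _) (hits-cancel _ _ _ _ _
        (neighbours-collide x _ _ _ (adj 0₃) (adj 1₃) (adj 2₃))) }
  where
  S₀≢S₁ : S 0₃ ≢ S 1₃
  S₀≢S₁ eq = noCN (commonNeighbour-triple v∈L v₀ (subst (Adj v) eq v₀) v₂)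
  S₀≢S₂ : S 0₃ ≢ S 2₃
  S₀≢S₂ eq = noCN (commonNeighbour-triple w∈L (subst (Adj w) (sym eq) w₂) w₁ w₂)
  S₁≢S₂ : S 1₃ ≢ S 2₃
  S₁≢S₂ eq = noCN (commonNeighbour-triple u∈L u₀ u₁ (subst (Adj u) eq u₁))

forbidden-up-to-three : ∀ (S : Fin r → Fin 6) → r ≤ 3 → ¬ HasCommonNeighbor L S →
                        TupleForbiddable 2 L S
forbidden-up-to-three S r≤3 noCN with m≤n⇒m<n∨m≡n r≤3
... | inj₁ (s≤s r≤2) = forbidden-short S r≤2 noCN
... | inj₂ refl      = forbidden-triple S noCN

lemma26 : (r : ℕ) → r ≤ 3 →
          (Ls : Fin r → Subset 6) → (∀ ℓ → IncomparableSet (Ls ℓ)) →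
          (L : Subset 6) →
          (S : Fin r → Fin 6) → InProduct Ls S → ¬ HasCommonNeighbor L S →
          (m : ℕ) (vs : Fin r → Fin m) → Injective _≡_ _≡_ vs →
          CanBeForbidden m vs Ls L S 2
lemma26 r r≤3 Ls _ L S _ noCN m vs _ =
  canBeForbidden vs Ls (forbidden-up-to-three S r≤3 noCN)
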